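{- Let $p$ be an odd prime, $m\ge1$, $q=p^m$, and let $\gamma\in GF(q^2)$ with $\gamma^2\ne\bar\gamma^2$. Let $B^1_{(c_1,r_1)}$ and $B^1_{(c_2,r_2)}$ be circles of the first type in $\mathbb M(q)$, each tangent to both $B^2_{(\gamma,0)}$ and $B^2_{(\bar\gamma,0)}$, with $c_1=\bar c_1$ and $c_2=-\bar c_2$. Then $B^1_{(c_1,r_1)}$ and $B^1_{(c_2,r_2)}$ are tangent if and only if \[ c_2=\pm c_1\cdot\frac{\gamma-\bar\gamma}{\gamma+\bar\gamma}. \]
   Context: $GF(q^2)$ is the quadratic extension of $GF(q)$ and $\bar z:=z^q$. The plane $\mathbb M(q)$ has point set $GF(q^2)\cup\{\infty\}$; its circles are $B^1_{(c,r)}=\{z\in GF(q^2):(z-c)(\bar z-\bar c)=r\}$ ($c\in GF(q^2)$, $r\in GF(q)\setminus\{0\}$; first type) and $B^2_{(c,r)}=\{z\in GF(q^2):\bar c z+c\bar z=r\}\cup\{\infty\}$ ($c\in GF(q^2)\setminus\{0\}$, $r\in GF(q)$; second type). Two distinct circles are tangent if they have exactly one common point. -}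

module Defs where

open import Level using (0ℓ)
open import Data.Nat using (ℕ; zero; suc)
open import Data.Fin using (Fin)
open import Data.Maybe using (Maybe; just; nothing)
open import Data.Product using (Σ; _×_)
open import Data.Unit using (⊤)
open import Data.Empty using (⊥)
open import Relation.Nullary using (¬_)
open import Relation.Binary.PropositionalEquality using (_≡_)
open import Algebra.Structures using (IsCommutativeRing)
open import Function.Bundles using (_⇔_; _⤖_)

record Field : Set₁ where
  infixl 7 _*_
  infixl 6 _+_
  infix 8 -_
  infix 9 _⁻¹
  field
    Carrier : Set
    _+_ _*_ : Carrier → Carrier → Carrier
    -_ _⁻¹  : Carrier → Carrier
    0# 1#   : Carrier
    isCommutativeRing : IsCommutativeRing _≡_ _+_ _*_ -_ 0# 1#
    0≢1      : ¬ (0# ≡ 1#)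
    ⁻¹-inv   : ∀ x → ¬ (x ≡ 0#) → x * x ⁻¹ ≡ 1#
    0⁻¹      : 0# ⁻¹ ≡ 0#

  _-_ : Carrier → Carrier → Carrier
  x - y = x + (- y)
  infixl 6 _-_

  pow : Carrier → ℕ → Carrier
  pow x zero    = 1#
  pow x (suc n) = x * pow x n

HasCard : Field → ℕ → Set
HasCard F n = Fin n ⤖ Field.Carrier F

-- The plane M(q) over a field F (intended: F = GF(q²)), with z̄ = z^q.
module Plane (F : Field) (q : ℕ) where
  open Field F

  bar : Carrier → Carrier
  bar z = pow z q

  -- membership in the subfield GF(q) = { r : r^q = r }
  InGFq : Carrier → Set
  InGFq r = bar r ≡ r

  -- points: GF(q²) ∪ {∞}, with ∞ = nothing
  Point : Set
  Point = Maybe Carrier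

  Circle : Set₁
  Circle = Point → Set

  B¹ : Carrier → Carrier → Circle
  B¹ c r nothing  = ⊥
  B¹ c r (just z) = (z - c) * (bar z - bar c) ≡ r

  B² : Carrier → Carrier → Circle
  B² c r nothing  = ⊤
  B² c r (just z) = bar c * z + c * bar z ≡ r

  Tangent : Circle → Circle → Set
  Tangent C D =
    ¬ (∀ x → C x ⇔ D x) ×
    Σ Point (λ x → C x × D x × (∀ y → C y → D y → y ≡ x))

-- z̄ = z ^ q is an involutive automorphism of GF(q²) (Frobenius, and Fermat's little theorem for
-- its q² elements), and 2 ≢ 0 because p is odd. In the coordinate v = z - c a circle
-- (z - c)(z̄ - c̄) = r and a line ḡ z + g z̄ = k read v v̄ = r and ḡ v + g v̄ = κ. The reflection
-- v ↦ g v̄ / ḡ preserves both, so a unique common point is fixed by it, which forces κ² = 4 g ḡ r;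
-- conversely v = κ / 2ḡ is then the only common point. Two circles of the first type meet exactly
-- where the first meets their radical axis, and a circle with r ≢ 0 has more than one point, so they
-- are tangent iff they meet once. Tangency of B¹(c₁,r₁) and B¹(c₂,r₂) to B²(γ,0) gives
-- 4γγ̄ r₁ = (c₁(γ + γ̄))² and 4γγ̄ r₂ = (c₂(γ - γ̄))²; substituting these, the tangency condition of
-- the two circles becomes (c₂²(γ + γ̄)² - c₁²(γ - γ̄)²)² = 0, i.e. c₂ = ± c₁ (γ - γ̄)/(γ + γ̄).

module Submission where

open import Defs
open import Data.Nat using (ℕ; _^_; _≤_)
open import Data.Nat.Primality using (Prime)
open import Data.Product using (_×_)
open import Data.Sum using (_⊎_)
open import Relation.Nullary using (¬_)
open import Relation.Binary.PropositionalEquality using (_≡_)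
open import Function.Bundles using (_⇔_)

open import Level using (0ℓ)
open import Algebra.Bundles using (CommutativeRing; CommutativeMonoid)
open import Relation.Binary.Definitions using (DecidableEquality)
open import Relation.Binary.PropositionalEquality using (_≢_)
import Function.Related.Propositional as Related

module PrimeArithmetic where
  open import Data.Nat
  open import Data.Nat.Properties
  open import Data.Nat.Combinatorics using (_C_; nCk≡n!/k![n-k]!; k![n∸k]!∣n!)
  open import Data.Nat.Divisibility using (_∣_; _∤_; ∣⇒≤; ∣1⇒≡1; m∣m*n; m%n≡0⇒n∣m)
  open import Data.Nat.DivMod using (m/n*n≡m; m%n<n)
  open import Data.Nat.Primality using (euclidsLemma; prime⇒nonTrivial; prime⇒nonZero; prime⇒irreducible)
  open import Data.Sum using (inj₁; inj₂)
  open import Data.Empty using (⊥-elim)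
  open import Relation.Binary.PropositionalEquality

  prime∤! : ∀ {p k} → Prime p → k < p → p ∤ k !
  prime∤! {k = zero}  p-prime _   p∣1 = nonTrivial⇒≢1 {{prime⇒nonTrivial p-prime}} (∣1⇒≡1 p∣1)
  prime∤! {k = suc k} p-prime k<p p∣k! with euclidsLemma (suc k) (k !) p-prime p∣k!
  ... | inj₁ p∣1+k = <⇒≱ k<p (∣⇒≤ p∣1+k)
  ... | inj₂ p∣k!  = prime∤! p-prime (<-trans (n<1+n k) k<p) p∣k!

  n∣n! : ∀ n → .{{NonZero n}} → n ∣ n !
  n∣n! (suc n) = m∣m*n (n !)

  nCk*k!*[n∸k]!≡n! : ∀ {n k} → k ≤ n → (n C k) * (k ! * (n ∸ k) !) ≡ n !
  nCk*k!*[n∸k]!≡n! {n} {k} k≤n = trans (cong (_* (k ! * (n ∸ k) !)) (nCk≡n!/k![n-k]! k≤n)) (m/n*n≡m (k![n∸k]!∣n! k≤n))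
    where instance _ = k !* (n ∸ k) !≢0

  prime∣binomial : ∀ {p k} → Prime p → 0 < k → k < p → p ∣ p C k
  prime∣binomial {p} {k} p-prime 0<k k<p with euclidsLemma (p C k) (k ! * (p ∸ k) !) p-prime p∣C*k!*[p∸k]!
    where
    p∣C*k!*[p∸k]! : p ∣ (p C k) * (k ! * (p ∸ k) !)
    p∣C*k!*[p∸k]! = subst (p ∣_) (sym (nCk*k!*[n∸k]!≡n! (<⇒≤ k<p))) (n∣n! p {{prime⇒nonZero p-prime}})
  ... | inj₁ p∣C = p∣C
  ... | inj₂ p∣k!*[p∸k]! with euclidsLemma (k !) ((p ∸ k) !) p-prime p∣k!*[p∸k]!
  ...   | inj₁ p∣k!     = ⊥-elim (prime∤! p-prime k<p p∣k!)
  ...   | inj₂ p∣[p∸k]! = ⊥-elim (prime∤! p-prime (∸-monoʳ-< 0<k (<⇒≤ k<p)) p∣[p∸k]!)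

  prime≢2⇒odd : ∀ {p} → Prime p → p ≢ 2 → p % 2 ≡ 1
  prime≢2⇒odd {p} p-prime p≢2 with p % 2 in p%2≡r | m%n<n p 2
  ... | 1 | _ = refl
  ... | 0 | _ with prime⇒irreducible p-prime (m%n≡0⇒n∣m p 2 p%2≡r)
  ...   | inj₂ 2≡p = ⊥-elim (p≢2 (sym 2≡p))
  prime≢2⇒odd p-prime p≢2 | suc (suc _) | s≤s (s≤s ())


-- Tactic.RingSolver takes its coefficients from the ring itself and cannot decide x - x = 0 in an
-- abstract field; with coefficients in ℤ the normal forms compute.
module IntegerCoefficientSolver {c ℓ} (R : CommutativeRing c ℓ) where
  open import Data.Nat as ℕ using (zero; suc)
  import Data.Nat.Properties as ℕ
  open import Data.Integer as ℤ using (ℤ; +_; -[1+_])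
  import Data.Integer.Properties as ℤ
  open import Data.Maybe using (Maybe; just; nothing)
  open import Relation.Nullary using (yes; no)
  import Relation.Binary.PropositionalEquality as ≡
  import Algebra.Properties.Ring as RingProperties
  import Algebra.Properties.Semiring.Mult.TCOptimised as TCMult
  open import Algebra.Solver.Ring.AlmostCommutativeRing
    using (fromCommutativeRing; _-Raw-AlmostCommutative⟶_)

  private
    open CommutativeRing R hiding (refl; sym; trans)
    open CommutativeRing R using () renaming (refl to ≈-refl; sym to ≈-sym; trans to ≈-trans)
    open RingProperties ring using (-‿involutive; -0#≈0#; -‿distribˡ-*; -‿distribʳ-*; -‿+-comm)
    open TCMult semiring using (×-homo-+; ×1-homo-*) renaming (_×_ to _×′_)
    open import Relation.Binary.Reasoning.Setoid setoid

    ⟦_⟧ : ℤ → Carrier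
    ⟦ + n ⟧      = n ×′ 1#
    ⟦ -[1+ n ] ⟧ = - (suc n ×′ 1#)

    1+x-[1+y]≈x-y : ∀ x y → (1# + x) - (1# + y) ≈ x - y
    1+x-[1+y]≈x-y x y = begin
      (1# + x) + - (1# + y)     ≈⟨ +-congˡ (-‿+-comm 1# y) ⟨
      (1# + x) + (- 1# + - y)   ≈⟨ +-congʳ (+-comm 1# x) ⟩
      (x + 1#) + (- 1# + - y)   ≈⟨ +-assoc x 1# _ ⟩
      x + (1# + (- 1# + - y))   ≈⟨ +-congˡ (+-assoc 1# (- 1#) (- y)) ⟨
      x + ((1# + - 1#) + - y)   ≈⟨ +-congˡ (+-congʳ (-‿inverseʳ 1#)) ⟩
      x + (0# + - y)            ≈⟨ +-congˡ (+-identityˡ (- y)) ⟩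
      x + - y                   ∎

    ⊖-homo : ∀ m n → ⟦ m ℤ.⊖ n ⟧ ≈ m ×′ 1# - n ×′ 1#
    ⊖-homo m zero = begin
      ⟦ m ℤ.⊖ 0 ⟧     ≡⟨ ≡.cong ⟦_⟧ (ℤ.⊖-≥ {m} ℕ.z≤n) ⟩
      m ×′ 1#         ≈⟨ +-identityʳ _ ⟨
      m ×′ 1# + 0#    ≈⟨ +-congˡ -0#≈0# ⟨
      m ×′ 1# - 0#    ∎
    ⊖-homo zero (suc n) = ≈-sym (+-identityˡ _)
    ⊖-homo (suc m) (suc n) = begin
      ⟦ suc m ℤ.⊖ suc n ⟧               ≡⟨ ≡.cong ⟦_⟧ (ℤ.[1+m]⊖[1+n]≡m⊖n m n) ⟩
      ⟦ m ℤ.⊖ n ⟧                       ≈⟨ ⊖-homo m n ⟩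
      m ×′ 1# - n ×′ 1#                 ≈⟨ 1+x-[1+y]≈x-y _ _ ⟨
      (1# + m ×′ 1#) - (1# + n ×′ 1#)   ≈⟨ +-cong (×-homo-+ 1# 1 m) (-‿cong (×-homo-+ 1# 1 n)) ⟨
      suc m ×′ 1# - suc n ×′ 1#         ∎

    -‿homo : ∀ i → ⟦ ℤ.- i ⟧ ≈ - ⟦ i ⟧
    -‿homo (+ zero)  = ≈-sym -0#≈0#
    -‿homo (+ suc n) = ≈-refl
    -‿homo -[1+ n ]  = ≈-sym (-‿involutive _)

    +-homo : ∀ i j → ⟦ i ℤ.+ j ⟧ ≈ ⟦ i ⟧ + ⟦ j ⟧
    +-homo (+ m)    (+ n)    = ×-homo-+ 1# m n
    +-homo (+ m)    -[1+ n ] = ⊖-homo m (suc n)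
    +-homo -[1+ m ] (+ n)    = ≈-trans (⊖-homo n (suc m)) (+-comm _ _)
    +-homo -[1+ m ] -[1+ n ] = begin
      - (suc (suc m ℕ.+ n) ×′ 1#)         ≡⟨ ≡.cong (λ k → - (suc k ×′ 1#)) (ℕ.+-suc m n) ⟨
      - ((suc m ℕ.+ suc n) ×′ 1#)         ≈⟨ -‿cong (×-homo-+ 1# (suc m) (suc n)) ⟩
      - (suc m ×′ 1# + suc n ×′ 1#)       ≈⟨ -‿+-comm _ _ ⟨
      - (suc m ×′ 1#) + - (suc n ×′ 1#)   ∎

    *-homo-+ : ∀ m j → ⟦ + m ℤ.* j ⟧ ≈ m ×′ 1# * ⟦ j ⟧
    *-homo-+ m (+ n) = ≈-trans (reflexive (≡.cong ⟦_⟧ (≡.sym (ℤ.pos-* m n)))) (×1-homo-* m n)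
    *-homo-+ m -[1+ n ] = begin
      ⟦ + m ℤ.* -[1+ n ] ⟧          ≡⟨ ≡.cong ⟦_⟧ (ℤ.neg-distribʳ-* (+ m) (+ suc n)) ⟨
      ⟦ ℤ.- (+ m ℤ.* + suc n) ⟧     ≈⟨ -‿homo (+ m ℤ.* + suc n) ⟩
      - ⟦ + m ℤ.* + suc n ⟧         ≈⟨ -‿cong (*-homo-+ m (+ suc n)) ⟩
      - (m ×′ 1# * suc n ×′ 1#)     ≈⟨ -‿distribʳ-* _ _ ⟩
      m ×′ 1# * - (suc n ×′ 1#)     ∎

    *-homo : ∀ i j → ⟦ i ℤ.* j ⟧ ≈ ⟦ i ⟧ * ⟦ j ⟧
    *-homo (+ m)    j = *-homo-+ m j
    *-homo -[1+ m ] j = begin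
      ⟦ -[1+ m ] ℤ.* j ⟧        ≡⟨ ≡.cong ⟦_⟧ (ℤ.neg-distribˡ-* (+ suc m) j) ⟨
      ⟦ ℤ.- (+ suc m ℤ.* j) ⟧   ≈⟨ -‿homo (+ suc m ℤ.* j) ⟩
      - ⟦ + suc m ℤ.* j ⟧       ≈⟨ -‿cong (*-homo-+ (suc m) j) ⟩
      - (suc m ×′ 1# * ⟦ j ⟧)   ≈⟨ -‿distribˡ-* _ _ ⟩
      - (suc m ×′ 1#) * ⟦ j ⟧   ∎

    ℤ⟶R : CommutativeRing.rawRing ℤ.+-*-commutativeRing -Raw-AlmostCommutative⟶ fromCommutativeRing R
    ℤ⟶R = record
      { ⟦_⟧ = ⟦_⟧ ; +-homo = +-homo ; *-homo = *-homo ; -‿homo = -‿homo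
      ; 0-homo = ≈-refl ; 1-homo = ≈-refl }

    ⟦⟧-equal? : ∀ i j → Maybe (⟦ i ⟧ ≈ ⟦ j ⟧)
    ⟦⟧-equal? i j with i ℤ.≟ j
    ... | yes i≡j = just (reflexive (≡.cong ⟦_⟧ i≡j))
    ... | no _    = nothing

  open import Algebra.Solver.Ring _ _ ℤ⟶R ⟦⟧-equal? public

module SumProperties {c ℓ} (M : CommutativeMonoid c ℓ) where
  import Relation.Binary.PropositionalEquality as ≡
  open import Data.Fin using (Fin; zero; suc)
  open import Data.Fin.Properties using (suc-injective)
  open import Data.Fin.Permutation using (Permutation; permutation)
  open import Data.Vec.Functional using (tail)
  open import Function.Base using (_∘_)
  open import Function.Bundles using (_⤖_; Inverse)
  open import Function.Properties.Bijection using (⤖⇒↔)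
  open CommutativeMonoid M
  open import Algebra.Properties.CommutativeMonoid.Sum M using (sum; sum-permute; sum-cong-≗)
  open import Algebra.Solver.CommutativeMonoid M using (solve; _⊕_; _⊜_)
  open import Relation.Binary.Reasoning.Setoid setoid

  sum-reindex : ∀ {a} {A : Set a} {n} (enumeration : Fin n ⤖ A) (f : A → Carrier) (σ σ⁻¹ : A → A) →
                (∀ y → σ (σ⁻¹ y) ≡ y) → (∀ y → σ⁻¹ (σ y) ≡ y) →
                let element = Inverse.to (⤖⇒↔ enumeration) in
                sum (λ i → f (σ (element i))) ≈ sum (λ i → f (element i))
  sum-reindex {n = n} enumeration f σ σ⁻¹ σσ⁻¹ σ⁻¹σ = begin
    sum (λ i → f (σ (element i)))                     ≡⟨ sum-cong-≗ (λ i → ≡.cong f (element-index (σ (element i)))) ⟨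
    sum (λ i → f (element (index (σ (element i)))))   ≈⟨ sum-permute (λ i → f (element i)) π ⟨
    sum (λ i → f (element i))                         ∎
    where
    open Inverse (⤖⇒↔ enumeration) using () renaming
      (to to element; from to index; strictlyInverseˡ to element-index; strictlyInverseʳ to index-element)
    π : Permutation n n
    π = permutation (λ i → index (σ (element i))) (λ j → index (σ⁻¹ (element j)))
          (λ j → ≡.trans (≡.cong (index ∘ σ) (element-index _)) (≡.trans (≡.cong index (σσ⁻¹ _)) (index-element j)))
          (λ i → ≡.trans (≡.cong (index ∘ σ⁻¹) (element-index _)) (≡.trans (≡.cong index (σ⁻¹σ _)) (index-element i)))

  sum-agree-except : ∀ {k} (t s : Fin k → Carrier) i₀ → (∀ i → i ≢ i₀ → t i ≡ s i) →
                     sum t ∙ s i₀ ≈ sum s ∙ t i₀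
  sum-agree-except t s zero t≡s = begin
    (t zero ∙ sum (tail t)) ∙ s zero   ≈⟨ ∙-congʳ (∙-congˡ (reflexive (sum-cong-≗ (λ i → t≡s (suc i) λ ())))) ⟩
    (t zero ∙ sum (tail s)) ∙ s zero   ≈⟨ solve 3 (λ a b c → (a ⊕ b) ⊕ c ⊜ (c ⊕ b) ⊕ a) refl _ _ _ ⟩
    (s zero ∙ sum (tail s)) ∙ t zero   ∎
  sum-agree-except t s (suc i₀) t≡s = begin
    (t zero ∙ sum (tail t)) ∙ s (suc i₀)   ≈⟨ assoc _ _ _ ⟩
    t zero ∙ (sum (tail t) ∙ s (suc i₀))   ≈⟨ ∙-cong (reflexive (t≡s zero λ ())) tail-agree ⟩
    s zero ∙ (sum (tail s) ∙ t (suc i₀))   ≈⟨ assoc _ _ _ ⟨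
    (s zero ∙ sum (tail s)) ∙ t (suc i₀)   ∎
    where
    tail-agree : sum (tail t) ∙ s (suc i₀) ≈ sum (tail s) ∙ t (suc i₀)
    tail-agree = sum-agree-except (tail t) (tail s) i₀ (λ i i≢i₀ → t≡s (suc i) (i≢i₀ ∘ suc-injective))

module FieldProperties (F : Field) where
  open Field F
  open import Function.Bundles using (mk⇔)
  open import Relation.Binary.PropositionalEquality using (refl; sym; trans; cong; cong₂; module ≡-Reasoning)
  open import Data.Sum using (inj₁; inj₂)
  open import Relation.Nullary using (yes; no)
  open import Data.Empty using (⊥-elim)
  import Data.Integer as ℤ
  open ≡-Reasoning

  commutativeRing : CommutativeRing 0ℓ 0ℓ
  commutativeRing = record { isCommutativeRing = isCommutativeRing }

  open CommutativeRing commutativeRing public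
    using (+-comm; +-identityˡ; +-identityʳ; -‿inverseʳ; *-comm; *-identityˡ; *-identityʳ; zeroˡ; zeroʳ;
           +-group; semiring; commutativeSemiring; +-commutativeMonoid; *-commutativeMonoid)
  open import Algebra.Properties.Group +-group public
    using (∙-cancelˡ; x∙y⁻¹≈ε⇒x≈y; x≈y⇒x∙y⁻¹≈ε; inverseˡ-unique)
  open IntegerCoefficientSolver commutativeRing public
    using (solve; _:=_; _:+_; _:*_; _:-_; :-_; con; Polynomial)

  import Data.Nat as ℕ
  import Algebra.Properties.Semiring.Exp semiring as Exp
  open import Algebra.Properties.CommutativeSemiring.Exp commutativeSemiring using (^-distrib-*)
  open import Algebra.Properties.Semiring.Mult semiring public using (×1-homo-*; ×-homo-1; ×-assoc-*)
    renaming (_×_ to _·_)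

  two : Carrier
  two = 1# + 1#

  :zero :two : ∀ {k} → Polynomial k
  :zero = con (ℤ.+ 0)
  :two  = con (ℤ.+ 2)

  pow≡^ : ∀ x k → pow x k ≡ x Exp.^ k
  pow≡^ x ℕ.zero    = refl
  pow≡^ x (ℕ.suc k) = cong (x *_) (pow≡^ x k)

  pow-distrib-* : ∀ x y k → pow (x * y) k ≡ pow x k * pow y k
  pow-distrib-* x y k = begin
    pow (x * y) k              ≡⟨ pow≡^ (x * y) k ⟩
    (x * y) Exp.^ k            ≡⟨ ^-distrib-* x y k ⟩
    x Exp.^ k * y Exp.^ k      ≡⟨ sym (cong₂ _*_ (pow≡^ x k) (pow≡^ y k)) ⟩
    pow x k * pow y k          ∎

  pow-pow : ∀ x j k → pow (pow x j) k ≡ pow x (j ℕ.* k)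
  pow-pow x j k = begin
    pow (pow x j) k            ≡⟨ trans (pow≡^ (pow x j) k) (cong (Exp._^ k) (pow≡^ x j)) ⟩
    (x Exp.^ j) Exp.^ k        ≡⟨ Exp.^-assocʳ x j k ⟩
    x Exp.^ (j ℕ.* k)          ≡⟨ sym (pow≡^ x (j ℕ.* k)) ⟩
    pow x (j ℕ.* k)            ∎

  _/_ : Carrier → Carrier → Carrier
  x / y = x * y ⁻¹
  infixl 7 _/_

  x*[y/x]≡y : ∀ {x} y → x ≢ 0# → x * (y / x) ≡ y
  x*[y/x]≡y {x} y x≢0 = begin
    x * (y * x ⁻¹)    ≡⟨ solve 3 (λ x y x⁻¹ → x :* (y :* x⁻¹) := y :* (x :* x⁻¹)) refl x y (x ⁻¹) ⟩
    y * (x * x ⁻¹)    ≡⟨ cong (y *_) (⁻¹-inv x x≢0) ⟩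
    y * 1#            ≡⟨ *-identityʳ y ⟩
    y                 ∎

  *-cancelˡ : ∀ {x} y z → x ≢ 0# → x * y ≡ x * z → y ≡ z
  *-cancelˡ {x} y z x≢0 xy≡xz = begin
    y                    ≡⟨ sym (x*[y/x]≡y y x≢0) ⟩
    x * (y * x ⁻¹)       ≡⟨ solve 3 (λ x y x⁻¹ → x :* (y :* x⁻¹) := x :* y :* x⁻¹) refl x y (x ⁻¹) ⟩
    x * y * x ⁻¹         ≡⟨ cong (_* x ⁻¹) xy≡xz ⟩
    x * z * x ⁻¹         ≡⟨ solve 3 (λ x z x⁻¹ → x :* z :* x⁻¹ := x :* (z :* x⁻¹)) refl x z (x ⁻¹) ⟩
    x * (z * x ⁻¹)       ≡⟨ x*[y/x]≡y z x≢0 ⟩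
    z                    ∎

  x*y≡0⇒y≡0 : ∀ {x y} → x ≢ 0# → x * y ≡ 0# → y ≡ 0#
  x*y≡0⇒y≡0 {x} {y} x≢0 xy≡0 = *-cancelˡ y 0# x≢0 (trans xy≡0 (sym (zeroʳ x)))

  x+y≡z⇒y≡z-x : ∀ {x y z} → x + y ≡ z → y ≡ z - x
  x+y≡z⇒y≡z-x {x} {y} {z} x+y≡z = begin
    y              ≡⟨ solve 2 (λ x y → y := x :+ y :- x) refl x y ⟩
    x + y - x      ≡⟨ cong (_- x) x+y≡z ⟩
    z - x          ∎

  x+y≡s⇒[x≡t⇔y≡s-t] : ∀ {x y s t} → x + y ≡ s → (x ≡ t ⇔ y ≡ s - t)
  x+y≡s⇒[x≡t⇔y≡s-t] {x} {y} {s} {t} x+y≡s = mk⇔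
    (λ x≡t → trans (x+y≡z⇒y≡z-x x+y≡s) (cong (λ w → s - w) x≡t))
    (λ y≡s-t → begin
      x                  ≡⟨ x+y≡z⇒y≡z-x (trans (+-comm y x) x+y≡s) ⟩
      s - y              ≡⟨ cong (λ w → s - w) y≡s-t ⟩
      s - (s - t)        ≡⟨ solve 2 (λ s t → s :- (s :- t) := t) refl s t ⟩
      t                  ∎)

  x*[x⁻¹*y]≡y : ∀ {x} → x ≢ 0# → ∀ y → x * (x ⁻¹ * y) ≡ y
  x*[x⁻¹*y]≡y {x} x≢0 y = trans (cong (x *_) (*-comm _ y)) (x*[y/x]≡y y x≢0)

  x⁻¹*[x*y]≡y : ∀ {x} → x ≢ 0# → ∀ y → x ⁻¹ * (x * y) ≡ y
  x⁻¹*[x*y]≡y {x} x≢0 y = *-cancelˡ _ y x≢0 (x*[x⁻¹*y]≡y x≢0 (x * y))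

  *-≢0 : ∀ {x y} → x ≢ 0# → y ≢ 0# → x * y ≢ 0#
  *-≢0 x≢0 y≢0 xy≡0 = y≢0 (x*y≡0⇒y≡0 x≢0 xy≡0)

  ^·1≡pow : ∀ a k → (a ℕ.^ k) · 1# ≡ pow (a · 1#) k
  ^·1≡pow a ℕ.zero    = ×-homo-1 1#
  ^·1≡pow a (ℕ.suc k) = trans (×1-homo-* a (a ℕ.^ k)) (cong (a · 1# *_) (^·1≡pow a k))

  1ᵏ≡1 : ∀ k → pow 1# k ≡ 1#
  1ᵏ≡1 ℕ.zero    = refl
  1ᵏ≡1 (ℕ.suc k) = trans (*-identityˡ _) (1ᵏ≡1 k)

  pow-≢0 : ∀ {x} k → x ≢ 0# → pow x k ≢ 0#
  pow-≢0 ℕ.zero    x≢0 1≡0 = 0≢1 (sym 1≡0)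
  pow-≢0 (ℕ.suc k) x≢0     = *-≢0 x≢0 (pow-≢0 k x≢0)

  module WithDecidableEquality (_≟_ : DecidableEquality Carrier) where

    x*y≡0⇒x≡0⊎y≡0 : ∀ {x y} → x * y ≡ 0# → x ≡ 0# ⊎ y ≡ 0#
    x*y≡0⇒x≡0⊎y≡0 {x} xy≡0 with x ≟ 0#
    ... | yes x≡0 = inj₁ x≡0
    ... | no  x≢0 = inj₂ (x*y≡0⇒y≡0 x≢0 xy≡0)

    x*x≡0⇒x≡0 : ∀ {x} → x * x ≡ 0# → x ≡ 0#
    x*x≡0⇒x≡0 xx≡0 with x*y≡0⇒x≡0⊎y≡0 xx≡0
    ... | inj₁ x≡0 = x≡0
    ... | inj₂ x≡0 = x≡0

    x*x≡y*y⇔x≡y⊎x≡-y : ∀ {x y} → x * x ≡ y * y ⇔ (x ≡ y ⊎ x ≡ - y)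
    x*x≡y*y⇔x≡y⊎x≡-y {x} {y} = mk⇔ roots (λ { (inj₁ refl) → refl ; (inj₂ refl) → [-y]²≡y² })
      where
      [-y]²≡y² : - y * - y ≡ y * y
      [-y]²≡y² = solve 1 (λ y → :- y :* :- y := y :* y) refl y
      [x-y][x+y]≡x²-y² : (x - y) * (x + y) ≡ x * x - y * y
      [x-y][x+y]≡x²-y² = solve 2 (λ x y → (x :- y) :* (x :+ y) := x :* x :- y :* y) refl x y
      roots : x * x ≡ y * y → x ≡ y ⊎ x ≡ - y
      roots x²≡y² with x*y≡0⇒x≡0⊎y≡0 (trans [x-y][x+y]≡x²-y² (x≈y⇒x∙y⁻¹≈ε x²≡y²))
      ... | inj₁ x-y≡0 = inj₁ (x∙y⁻¹≈ε⇒x≈y x y x-y≡0)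
      ... | inj₂ x+y≡0 = inj₂ (inverseˡ-unique x y x+y≡0)

    pow≡0⇒≡0 : ∀ {x} k → pow x k ≡ 0# → x ≡ 0#
    pow≡0⇒≡0 {x} k xᵏ≡0 with x ≟ 0#
    ... | yes x≡0 = x≡0
    ... | no  x≢0 = ⊥-elim (pow-≢0 k x≢0 xᵏ≡0)

  module Finite {n : ℕ} (card : HasCard F n) where
    open import Relation.Nullary.Decidable using (map′)
    open import Data.Fin as Fin using (Fin; zero; suc)
    open import Function.Bundles using (Inverse)
    open import Function.Base using (_∘_)
    open import Data.Vec.Functional using (tail)
    open import Function.Properties.Bijection using (⤖⇒↔)
    import Algebra.Properties.CommutativeMonoid.Sum as Sum

    open Inverse (⤖⇒↔ card) using ()
      renaming (to to element; from to index; strictlyInverseˡ to element-index; strictlyInverseʳ to index-element)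

    _≟_ : DecidableEquality Carrier
    x ≟ y = map′ element-injective (cong index) (index x Fin.≟ index y)
      where
      element-injective : index x ≡ index y → x ≡ y
      element-injective i≡j = trans (sym (element-index x)) (trans (cong element i≡j) (element-index y))

    open Sum +-commutativeMonoid using (∑-distrib-+; sum-replicate) renaming (sum to ∑)
    open SumProperties +-commutativeMonoid using () renaming (sum-reindex to ∑-reindex)
    open SumProperties *-commutativeMonoid using () renaming (sum-reindex to ∏-reindex; sum-agree-except to ∏-agree-except)
    open Sum *-commutativeMonoid using () renaming
      (sum to ∏; sum-cong-≗ to ∏-cong-≗; ∑-distrib-+ to ∏-distrib-*; sum-replicate to ∏-replicate)

    n·x≡0 : ∀ x → n · x ≡ 0#
    n·x≡0 x = ∙-cancelˡ (∑ element) (n · x) 0# (begin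
      ∑ element + n · x                 ≡⟨ cong (∑ element +_) (sum-replicate n) ⟨
      ∑ element + ∑ {n} (λ _ → x)       ≡⟨ ∑-distrib-+ element (λ _ → x) ⟨
      ∑ (λ i → element i + x)           ≡⟨ ∑-reindex card (λ y → y) (_+ x) (_- x) x-x+x≡x x+x-x≡x ⟩
      ∑ element                         ≡⟨ +-identityʳ _ ⟨
      ∑ element + 0#                    ∎)
      where
      x-x+x≡x : ∀ y → y - x + x ≡ y
      x-x+x≡x y = solve 2 (λ y x → y :- x :+ x := y) refl y x
      x+x-x≡x : ∀ y → y + x - x ≡ y
      x+x-x≡x y = solve 2 (λ y x → y :+ x :- x := y) refl y x

    ∏-≢0 : ∀ {k} (t : Fin k → Carrier) → (∀ i → t i ≢ 0#) → ∏ t ≢ 0#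
    ∏-≢0 {ℕ.zero}  t _   1≡0 = 0≢1 (sym 1≡0)
    ∏-≢0 {ℕ.suc k} t t≢0     = *-≢0 (t≢0 zero) (∏-≢0 (tail t) (t≢0 ∘ suc))

    infix 8 _[0↦_]
    _[0↦_] : Carrier → Carrier → Carrier
    y [0↦ a ] with y ≟ 0#
    ... | yes _ = a
    ... | no  _ = y

    0[0↦a]≡a : ∀ a → 0# [0↦ a ] ≡ a
    0[0↦a]≡a a with 0# ≟ 0#
    ... | yes _   = refl
    ... | no 0≢0  = ⊥-elim (0≢0 refl)

    y[0↦a]≡y : ∀ {y} a → y ≢ 0# → y [0↦ a ] ≡ y
    y[0↦a]≡y {y} a y≢0 with y ≟ 0#
    ... | yes y≡0 = ⊥-elim (y≢0 y≡0)
    ... | no  _   = refl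

    y[0↦1]≢0 : ∀ y → y [0↦ 1# ] ≢ 0#
    y[0↦1]≢0 y with y ≟ 0#
    ... | yes _   = λ 1≡0 → 0≢1 (sym 1≡0)
    ... | no  y≢0 = y≢0

    x*y[0↦1]≡[x*y][0↦x] : ∀ {x} y → x ≢ 0# → x * y [0↦ 1# ] ≡ (x * y) [0↦ x ]
    x*y[0↦1]≡[x*y][0↦x] {x} y x≢0 with y ≟ 0#
    ... | yes refl = trans (*-identityʳ x) (sym (trans (cong (_[0↦ x ]) (zeroʳ x)) (0[0↦a]≡a x)))
    ... | no  y≢0  = sym (y[0↦a]≡y x (*-≢0 x≢0 y≢0))

    ∏[0↦_] : Carrier → Carrier
    ∏[0↦ a ] = ∏ (λ i → element i [0↦ a ])

    ∏[0↦1]≢0 : ∏[0↦ 1# ] ≢ 0#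
    ∏[0↦1]≢0 = ∏-≢0 _ (λ i → y[0↦1]≢0 (element i))

    ∏[0↦a]≡∏[0↦1]*a : ∀ a → ∏[0↦ a ] ≡ ∏[0↦ 1# ] * a
    ∏[0↦a]≡∏[0↦1]*a a = begin
      ∏[0↦ a ]                          ≡⟨ *-identityʳ _ ⟨
      ∏[0↦ a ] * 1#                     ≡⟨ cong (∏[0↦ a ] *_) (element-0ᵢ[0↦b]≡b 1#) ⟨
      ∏[0↦ a ] * element 0ᵢ [0↦ 1# ]    ≡⟨ ∏-agree-except _ _ 0ᵢ agree ⟩
      ∏[0↦ 1# ] * element 0ᵢ [0↦ a ]    ≡⟨ cong (∏[0↦ 1# ] *_) (element-0ᵢ[0↦b]≡b a) ⟩
      ∏[0↦ 1# ] * a                     ∎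
      where
      0ᵢ : Fin n
      0ᵢ = index 0#
      element-0ᵢ[0↦b]≡b : ∀ b → element 0ᵢ [0↦ b ] ≡ b
      element-0ᵢ[0↦b]≡b b = trans (cong _[0↦ b ] (element-index 0#)) (0[0↦a]≡a b)
      agree : ∀ i → i ≢ 0ᵢ → element i [0↦ a ] ≡ element i [0↦ 1# ]
      agree i i≢0ᵢ = trans (y[0↦a]≡y a element≢0) (sym (y[0↦a]≡y 1# element≢0))
        where
        element≢0 : element i ≢ 0#
        element≢0 eᵢ≡0 = i≢0ᵢ (trans (sym (index-element i)) (cong index eᵢ≡0))

    -- For x ≢ 0#, multiplication by x permutes F and turns ∏[0↦ 1# ] into pow x n * ∏[0↦ 1# ].
    fermat : ∀ x → pow x n ≡ x
    fermat x with x ≟ 0#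
    ... | yes refl = 0ᵏ≡0 (index 0#)
      where
      0ᵏ≡0 : ∀ {k} → Fin k → pow 0# k ≡ 0#
      0ᵏ≡0 {ℕ.suc k} _ = zeroˡ _
    ... | no x≢0 = *-cancelˡ (pow x n) x ∏[0↦1]≢0 (begin
      ∏[0↦ 1# ] * pow x n                       ≡⟨ *-comm _ _ ⟩
      pow x n * ∏[0↦ 1# ]                       ≡⟨ cong (_* ∏[0↦ 1# ]) (trans (pow≡^ x n) (sym (∏-replicate n))) ⟩
      ∏ {n} (λ _ → x) * ∏[0↦ 1# ]               ≡⟨ ∏-distrib-* (λ _ → x) (λ i → element i [0↦ 1# ]) ⟨
      ∏ (λ i → x * element i [0↦ 1# ])          ≡⟨ ∏-cong-≗ (λ i → x*y[0↦1]≡[x*y][0↦x] (element i) x≢0) ⟩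
      ∏ (λ i → (x * element i) [0↦ x ])         ≡⟨ ∏-reindex card _[0↦ x ] (x *_) (x ⁻¹ *_)
                                                                (x*[x⁻¹*y]≡y x≢0) (x⁻¹*[x*y]≡y x≢0) ⟩
      ∏[0↦ x ]                                  ≡⟨ ∏[0↦a]≡∏[0↦1]*a x ⟩
      ∏[0↦ 1# ] * x                             ∎)

  module Characteristic {p : ℕ} (p-prime : Prime p) (p·1≡0 : p · 1# ≡ 0#) where

    import Data.Nat.Properties as ℕ
    open import Data.Nat.Combinatorics using (_C_; nCn≡1; nCk≡nC[n∸k])
    open import Data.Nat.Divisibility using (_∣_; divides-refl)
    open import Data.Fin as Fin using (Fin; zero; suc; inject₁; fromℕ)
    import Data.Fin.Properties as Fin
    import Algebra.Properties.CommutativeMonoid.Sum as Sum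
    open import Algebra.Properties.CommutativeSemiring.Binomial commutativeSemiring using (theorem; binomialTerm)
    open import Data.Nat.Primality using (prime⇒nonZero)
    open PrimeArithmetic using (prime∣binomial; prime≢2⇒odd)
    open import Data.Nat.DivMod using (m≡m%n+[m/n]*n)
    open import Algebra.Properties.Semiring.Mult semiring using (×-homo-+)
    open Sum +-commutativeMonoid using () renaming (sum to ∑)

    ∣⇒·≡0 : ∀ {c} x → p ∣ c → c · x ≡ 0#
    ∣⇒·≡0 {c} x (divides-refl t) = begin
      (t ℕ.* p) · x               ≡⟨ cong ((t ℕ.* p) ·_) (*-identityˡ x) ⟨
      (t ℕ.* p) · (1# * x)        ≡⟨ ×-assoc-* (t ℕ.* p) 1# x ⟨
      (t ℕ.* p) · 1# * x          ≡⟨ cong (_* x) (×1-homo-* t p) ⟩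
      t · 1# * p · 1# * x         ≡⟨ cong (λ z → t · 1# * z * x) p·1≡0 ⟩
      t · 1# * 0# * x             ≡⟨ cong (_* x) (zeroʳ _) ⟩
      0# * x                      ≡⟨ zeroˡ x ⟩
      0#                          ∎

    ∑-last : ∀ n (t : Fin (ℕ.suc n) → Carrier) → (∀ j → t (inject₁ j) ≡ 0#) → ∑ t ≡ t (fromℕ n)
    ∑-last ℕ.zero    t _      = +-identityʳ _
    ∑-last (ℕ.suc n) t t≡0 = begin
      t zero + ∑ (λ j → t (suc j))  ≡⟨ cong₂ _+_ (t≡0 zero) (∑-last n (λ j → t (suc j)) (λ j → t≡0 (suc j))) ⟩
      0# + t (fromℕ (ℕ.suc n))      ≡⟨ +-identityˡ _ ⟩
      t (fromℕ (ℕ.suc n))           ∎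

    frobenius : ∀ x y → pow (x + y) p ≡ pow x p + pow y p
    frobenius x y = expand (ℕ.suc-pred p {{prime⇒nonZero p-prime}})
      where
      term : Fin (ℕ.suc p) → Carrier
      term = binomialTerm x y p
      expand : ∀ {n} → ℕ.suc n ≡ p → pow (x + y) p ≡ pow x p + pow y p
      expand {n} refl = begin
        pow (x + y) p
          ≡⟨ pow≡^ (x + y) p ⟩
        (x + y) Exp.^ p
          ≡⟨ theorem p x y ⟩
        term zero + ∑ (λ j → term (suc j))
          ≡⟨ cong (term zero +_) (∑-last n (λ j → term (suc j)) interior≡0) ⟩
        term zero + term (fromℕ p)
          ≡⟨ +-comm _ _ ⟩
        term (fromℕ p) + term zero
          ≡⟨ cong₂ _+_ last first ⟩
        pow x p + pow y p ∎
        where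
        interior≡0 : ∀ j → term (suc (inject₁ j)) ≡ 0#
        interior≡0 j = ∣⇒·≡0 _ (prime∣binomial p-prime (ℕ.s≤s ℕ.z≤n)
          (ℕ.s≤s (ℕ.≤-trans (ℕ.s≤s (ℕ.≤-reflexive (Fin.toℕ-inject₁ j))) (Fin.toℕ<n j))))
        first : term zero ≡ pow y p
        first = begin
          (p C 0) · (1# * y Exp.^ p)
            ≡⟨ cong (_· (1# * y Exp.^ p)) (trans (nCk≡nC[n∸k] {0} {p} ℕ.z≤n) (nCn≡1 p)) ⟩
          1 · (1# * y Exp.^ p)
            ≡⟨ trans (×-homo-1 _) (*-identityˡ _) ⟩
          y Exp.^ p
            ≡⟨ pow≡^ y p ⟨
          pow y p ∎
        last : term (fromℕ p) ≡ pow x p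
        last = begin
          term (fromℕ p)
            ≡⟨ cong (λ k → (p C k) · (x Exp.^ k * y Exp.^ (p ℕ.∸ k))) (Fin.toℕ-fromℕ p) ⟩
          (p C p) · (x Exp.^ p * y Exp.^ (p ℕ.∸ p))
            ≡⟨ cong₂ (λ c k → c · (x Exp.^ p * y Exp.^ k)) (nCn≡1 p) (ℕ.n∸n≡0 p) ⟩
          1 · (x Exp.^ p * 1#)
            ≡⟨ trans (×-homo-1 _) (*-identityʳ _) ⟩
          x Exp.^ p
            ≡⟨ pow≡^ x p ⟨
          pow x p ∎

    frobenius-^ : ∀ k x y → pow (x + y) (p ℕ.^ k) ≡ pow x (p ℕ.^ k) + pow y (p ℕ.^ k)
    frobenius-^ ℕ.zero x y = trans (*-identityʳ _) (sym (cong₂ _+_ (*-identityʳ x) (*-identityʳ y)))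
    frobenius-^ (ℕ.suc k) x y = begin
      pow (x + y) (p ℕ.* p ℕ.^ k)
        ≡⟨ pow-pow (x + y) p (p ℕ.^ k) ⟨
      pow (pow (x + y) p) (p ℕ.^ k)
        ≡⟨ cong (λ z → pow z (p ℕ.^ k)) (frobenius x y) ⟩
      pow (pow x p + pow y p) (p ℕ.^ k)
        ≡⟨ frobenius-^ k (pow x p) (pow y p) ⟩
      pow (pow x p) (p ℕ.^ k) + pow (pow y p) (p ℕ.^ k)
        ≡⟨ cong₂ _+_ (pow-pow x p (p ℕ.^ k)) (pow-pow y p (p ℕ.^ k)) ⟩
      pow x (p ℕ.* p ℕ.^ k) + pow y (p ℕ.* p ℕ.^ k) ∎

    odd⇒two≢0 : p ≢ 2 → two ≢ 0#
    odd⇒two≢0 p≢2 two≡0 = 0≢1 (begin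
      0#
        ≡⟨ p·1≡0 ⟨
      p · 1#
        ≡⟨ cong (_· 1#) p≡1+[p/2]*2 ⟩
      (1 ℕ.+ p ℕ./ 2 ℕ.* 2) · 1#
        ≡⟨ ×-homo-+ 1# 1 (p ℕ./ 2 ℕ.* 2) ⟩
      1 · 1# + (p ℕ./ 2 ℕ.* 2) · 1#
        ≡⟨ cong₂ _+_ (×-homo-1 1#) (×1-homo-* (p ℕ./ 2) 2) ⟩
      1# + (p ℕ./ 2) · 1# * 2 · 1#
        ≡⟨ cong (λ z → 1# + (p ℕ./ 2) · 1# * z) (trans (cong (1# +_) (+-identityʳ 1#)) two≡0) ⟩
      1# + (p ℕ./ 2) · 1# * 0#
        ≡⟨ trans (cong (1# +_) (zeroʳ _)) (+-identityʳ 1#) ⟩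
      1# ∎)
      where
      p≡1+[p/2]*2 : p ≡ 1 ℕ.+ p ℕ./ 2 ℕ.* 2
      p≡1+[p/2]*2 = trans (m≡m%n+[m/n]*n p 2) (cong (ℕ._+ p ℕ./ 2 ℕ.* 2) (prime≢2⇒odd p-prime p≢2))

module PlaneGeometry (F : Field) (q : ℕ) where
  open Field F
  open FieldProperties F
  open Plane F q

  module WithConjugation (_≟_ : DecidableEquality Carrier) (two≢0 : two ≢ 0#)
    (bar-+ : ∀ x y → bar (x + y) ≡ bar x + bar y)
    (bar-* : ∀ x y → bar (x * y) ≡ bar x * bar y)
    (bar-bar : ∀ x → bar (bar x) ≡ x)
    where

    open import Relation.Binary.PropositionalEquality using (refl; sym; trans; cong; cong₂; module ≡-Reasoning)
    open import Relation.Nullary using (yes; no)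
    open import Data.Maybe using (just)
    open import Data.Maybe.Properties using (just-injective)
    open import Function.Bundles using (mk⇔; Equivalence)
    open import Function.Properties.Equivalence using () renaming (sym to ⇔-sym; trans to ⇔-trans)
    open import Data.Product using (Σ; _,_; proj₁; proj₂)
    open WithDecidableEquality _≟_
    open ≡-Reasoning

    bar-0 : bar 0# ≡ 0#
    bar-0 = ∙-cancelˡ (bar 0#) (bar 0#) 0# (begin
      bar 0# + bar 0#    ≡⟨ bar-+ 0# 0# ⟨
      bar (0# + 0#)      ≡⟨ cong bar (+-identityʳ 0#) ⟩
      bar 0#             ≡⟨ +-identityʳ _ ⟨
      bar 0# + 0#        ∎)

    bar-1 : bar 1# ≡ 1#
    bar-1 = 1ᵏ≡1 q

    bar-neg : ∀ x → bar (- x) ≡ - bar x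
    bar-neg x = ∙-cancelˡ (bar x) (bar (- x)) (- bar x) (begin
      bar x + bar (- x)  ≡⟨ bar-+ x (- x) ⟨
      bar (x - x)        ≡⟨ cong bar (-‿inverseʳ x) ⟩
      bar 0#             ≡⟨ bar-0 ⟩
      0#                 ≡⟨ -‿inverseʳ (bar x) ⟨
      bar x - bar x      ∎)

    bar-- : ∀ x y → bar (x - y) ≡ bar x - bar y
    bar-- x y = trans (bar-+ x (- y)) (cong (bar x +_) (bar-neg y))

    bar-two : bar two ≡ two
    bar-two = trans (bar-+ 1# 1#) (cong₂ _+_ bar-1 bar-1)

    bar-≢0 : ∀ {x} → x ≢ 0# → bar x ≢ 0#
    bar-≢0 {x} x≢0 x̄≡0 = x≢0 (trans (sym (bar-bar x)) (trans (cong bar x̄≡0) bar-0))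

    bar-⁻¹ : ∀ x → bar (x ⁻¹) ≡ bar x ⁻¹
    bar-⁻¹ x with x ≟ 0#
    ... | yes refl = trans (cong bar 0⁻¹) (trans bar-0 (trans (sym 0⁻¹) (cong _⁻¹ (sym bar-0))))
    ... | no  x≢0  = *-cancelˡ (bar (x ⁻¹)) (bar x ⁻¹) (bar-≢0 x≢0) (begin
      bar x * bar (x ⁻¹)    ≡⟨ bar-* x (x ⁻¹) ⟨
      bar (x * x ⁻¹)        ≡⟨ cong bar (⁻¹-inv x x≢0) ⟩
      bar 1#                ≡⟨ bar-1 ⟩
      1#                    ≡⟨ ⁻¹-inv (bar x) (bar-≢0 x≢0) ⟨
      bar x * bar x ⁻¹      ∎)

    bar-/ : ∀ x y → bar (x / y) ≡ bar x / bar y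
    bar-/ x y = trans (bar-* x (y ⁻¹)) (cong (bar x *_) (bar-⁻¹ y))

    bar-norm : ∀ x → bar (x * bar x) ≡ x * bar x
    bar-norm x = trans (bar-* x (bar x)) (trans (cong (bar x *_) (bar-bar x)) (*-comm _ _))

    UniqueIntersection : Circle → Circle → Set
    UniqueIntersection C D = Σ Point λ x → C x × D x × (∀ y → C y → D y → y ≡ x)

    -- In the coordinate v = z - c the line B² g k reads bar g * v + g * bar v ≡ offset c g k.
    offset : Carrier → Carrier → Carrier → Carrier
    offset c g k = k - (bar g * c + g * bar c)

    module CircleLine {c r g k : Carrier} (g≢0 : g ≢ 0#) (k-real : InGFq k) where

      ḡ : Carrier
      ḡ = bar g

      κ : Carrier
      κ = offset c g k

      OnCentered : Carrier → Set
      OnCentered v = v * bar v ≡ r × ḡ * v + g * bar v ≡ κ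

      centered : ∀ z → B¹ c r (just z) → B² g k (just z) → OnCentered (z - c)
      centered z on-circle on-line = trans (cong ((z - c) *_) (bar-- z c)) on-circle , (begin
        ḡ * (z - c) + g * bar (z - c)
          ≡⟨ cong (λ w → ḡ * (z - c) + g * w) (bar-- z c) ⟩
        ḡ * (z - c) + g * (bar z - bar c)
          ≡⟨ solve 6 (λ ḡ g z c z̄ c̄ → ḡ :* (z :- c) :+ g :* (z̄ :- c̄)
                                        := (ḡ :* z :+ g :* z̄) :- (ḡ :* c :+ g :* c̄)) refl ḡ g z c (bar z) (bar c) ⟩
        (ḡ * z + g * bar z) - (ḡ * c + g * bar c)
          ≡⟨ cong (_- (ḡ * c + g * bar c)) on-line ⟩
        κ ∎)

      uncentered : ∀ v → OnCentered v → B¹ c r (just (c + v)) × B² g k (just (c + v))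
      uncentered v (on-circle , on-line) = (begin
        (c + v - c) * (bar (c + v) - bar c)
          ≡⟨ cong (λ w → (c + v - c) * (w - bar c)) (bar-+ c v) ⟩
        (c + v - c) * (bar c + bar v - bar c)
          ≡⟨ solve 4 (λ c v c̄ v̄ → (c :+ v :- c) :* (c̄ :+ v̄ :- c̄) := v :* v̄) refl c v (bar c) (bar v) ⟩
        v * bar v
          ≡⟨ on-circle ⟩
        r ∎) , (begin
        ḡ * (c + v) + g * bar (c + v)
          ≡⟨ cong (λ w → ḡ * (c + v) + g * w) (bar-+ c v) ⟩
        ḡ * (c + v) + g * (bar c + bar v)
          ≡⟨ solve 6 (λ ḡ g c v c̄ v̄ → ḡ :* (c :+ v) :+ g :* (c̄ :+ v̄)
                                        := (ḡ :* v :+ g :* v̄) :+ (ḡ :* c :+ g :* c̄)) refl ḡ g c v (bar c) (bar v) ⟩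
        (ḡ * v + g * bar v) + (ḡ * c + g * bar c)
          ≡⟨ cong (_+ (ḡ * c + g * bar c)) on-line ⟩
        k - (ḡ * c + g * bar c) + (ḡ * c + g * bar c)
          ≡⟨ solve 2 (λ k s → k :- s :+ s := k) refl k (ḡ * c + g * bar c) ⟩
        k ∎)

      ḡ≢0 : ḡ ≢ 0#
      ḡ≢0 = bar-≢0 g≢0

      -- Reflection in the diameter perpendicular to the line.
      reflect : Carrier → Carrier
      reflect v = g * bar v / ḡ

      ḡ*reflect : ∀ v → ḡ * reflect v ≡ g * bar v
      ḡ*reflect v = x*[y/x]≡y (g * bar v) ḡ≢0

      g*bar-reflect : ∀ v → g * bar (reflect v) ≡ ḡ * v
      g*bar-reflect v = begin
        g * bar (g * bar v / ḡ)
          ≡⟨ cong (g *_) (trans (bar-/ (g * bar v) ḡ) (cong₂ _/_ (bar-* g (bar v)) (bar-bar g))) ⟩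
        g * (ḡ * bar (bar v) / g)
          ≡⟨ cong (λ w → g * (ḡ * w / g)) (bar-bar v) ⟩
        g * (ḡ * v / g)
          ≡⟨ x*[y/x]≡y (ḡ * v) g≢0 ⟩
        ḡ * v ∎

      reflect-OnCentered : ∀ {v} → OnCentered v → OnCentered (reflect v)
      reflect-OnCentered {v} (on-circle , on-line) = circle , line
        where
        w : Carrier
        w = reflect v
        circle : w * bar w ≡ r
        circle = *-cancelˡ (w * bar w) r (*-≢0 ḡ≢0 g≢0) (begin
          ḡ * g * (w * bar w)
            ≡⟨ solve 4 (λ ḡ g w w̄ → ḡ :* g :* (w :* w̄) := (ḡ :* w) :* (g :* w̄)) refl ḡ g w (bar w) ⟩
          (ḡ * w) * (g * bar w)
            ≡⟨ cong₂ _*_ (ḡ*reflect v) (g*bar-reflect v) ⟩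
          (g * bar v) * (ḡ * v)
            ≡⟨ solve 4 (λ ḡ g v v̄ → (g :* v̄) :* (ḡ :* v) := ḡ :* g :* (v :* v̄)) refl ḡ g v (bar v) ⟩
          ḡ * g * (v * bar v)
            ≡⟨ cong (ḡ * g *_) on-circle ⟩
          ḡ * g * r ∎)
        line : ḡ * w + g * bar w ≡ κ
        line = trans (cong₂ _+_ (ḡ*reflect v) (g*bar-reflect v)) (trans (+-comm _ _) on-line)

      unique⇒ : UniqueIntersection (B¹ c r) (B² g k) → κ * κ ≡ two * two * (g * ḡ) * r
      unique⇒ (just z , on-circle , on-line , unique) = begin
        κ * κ
          ≡⟨ cong₂ _*_ (sym line) (sym line) ⟩
        (ḡ * v + g * bar v) * (ḡ * v + g * bar v)
          ≡⟨ cong₂ (λ s t → (ḡ * v + s) * (t + g * bar v)) g*v̄≡ḡ*v (sym g*v̄≡ḡ*v) ⟩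
        (ḡ * v + ḡ * v) * (g * bar v + g * bar v)
          ≡⟨ solve 4 (λ ḡ g v v̄ → (ḡ :* v :+ ḡ :* v) :* (g :* v̄ :+ g :* v̄)
                                   := :two :* :two :* (g :* ḡ) :* (v :* v̄)) refl ḡ g v (bar v) ⟩
        two * two * (g * ḡ) * (v * bar v)
          ≡⟨ cong (two * two * (g * ḡ) *_) circle ⟩
        two * two * (g * ḡ) * r ∎
        where
        v : Carrier
        v = z - c
        on-centered : OnCentered v
        on-centered = centered z on-circle on-line
        circle : v * bar v ≡ r
        circle = proj₁ on-centered
        line : ḡ * v + g * bar v ≡ κ
        line = proj₂ on-centered
        reflection-on-both : B¹ c r (just (c + reflect v)) × B² g k (just (c + reflect v))
        reflection-on-both = uncentered (reflect v) (reflect-OnCentered on-centered)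
        reflect-v≡v : reflect v ≡ v
        reflect-v≡v = x+y≡z⇒y≡z-x (just-injective
          (unique (just (c + reflect v)) (proj₁ reflection-on-both) (proj₂ reflection-on-both)))
        g*v̄≡ḡ*v : g * bar v ≡ ḡ * v
        g*v̄≡ḡ*v = trans (sym (ḡ*reflect v)) (cong (ḡ *_) reflect-v≡v)

      κ-real : bar κ ≡ κ
      κ-real = begin
        bar (k - (ḡ * c + g * bar c))         ≡⟨ bar-- k _ ⟩
        bar k - bar (ḡ * c + g * bar c)       ≡⟨ cong₂ _-_ k-real (bar-+ (ḡ * c) (g * bar c)) ⟩
        k - (bar (ḡ * c) + bar (g * bar c))   ≡⟨ cong₂ (λ s t → k - (s + t)) bar-ḡc bar-gc̄ ⟩
        k - (g * bar c + ḡ * c)               ≡⟨ cong (λ s → k - s) (+-comm _ _) ⟩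
        κ                                     ∎
        where
        bar-ḡc : bar (ḡ * c) ≡ g * bar c
        bar-ḡc = trans (bar-* ḡ c) (cong (_* bar c) (bar-bar g))
        bar-gc̄ : bar (g * bar c) ≡ ḡ * c
        bar-gc̄ = trans (bar-* g (bar c)) (cong (ḡ *_) (bar-bar c))

      2ḡ≢0 : two * ḡ ≢ 0#
      2ḡ≢0 = *-≢0 two≢0 ḡ≢0

      2g≢0 : two * g ≢ 0#
      2g≢0 = *-≢0 two≢0 g≢0

      v₀ : Carrier
      v₀ = κ / (two * ḡ)

      2ḡ*v₀≡κ : two * ḡ * v₀ ≡ κ
      2ḡ*v₀≡κ = x*[y/x]≡y κ 2ḡ≢0

      2g*v̄₀≡κ : two * g * bar v₀ ≡ κ
      2g*v̄₀≡κ = begin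
        two * g * bar (κ / (two * ḡ))       ≡⟨ cong (two * g *_) (bar-/ κ (two * ḡ)) ⟩
        two * g * (bar κ / bar (two * ḡ))   ≡⟨ cong₂ (λ s t → two * g * (s / t)) κ-real bar-2ḡ ⟩
        two * g * (κ / (two * g))           ≡⟨ x*[y/x]≡y κ 2g≢0 ⟩
        κ                                   ∎
        where
        bar-2ḡ : bar (two * ḡ) ≡ two * g
        bar-2ḡ = trans (bar-* two ḡ) (cong₂ _*_ bar-two (bar-bar g))

      v₀-OnCentered : κ * κ ≡ two * two * (g * ḡ) * r → OnCentered v₀
      v₀-OnCentered κ²≡4gḡr = circle , line
        where
        circle : v₀ * bar v₀ ≡ r
        circle = *-cancelˡ (v₀ * bar v₀) r (*-≢0 2ḡ≢0 2g≢0) (begin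
          two * ḡ * (two * g) * (v₀ * bar v₀)
            ≡⟨ solve 5 (λ t ḡ g v v̄ → t :* ḡ :* (t :* g) :* (v :* v̄) := (t :* ḡ :* v) :* (t :* g :* v̄))
                       refl two ḡ g v₀ (bar v₀) ⟩
          (two * ḡ * v₀) * (two * g * bar v₀)
            ≡⟨ cong₂ _*_ 2ḡ*v₀≡κ 2g*v̄₀≡κ ⟩
          κ * κ
            ≡⟨ κ²≡4gḡr ⟩
          two * two * (g * ḡ) * r
            ≡⟨ solve 4 (λ t g ḡ r → t :* t :* (g :* ḡ) :* r := t :* ḡ :* (t :* g) :* r) refl two g ḡ r ⟩
          two * ḡ * (two * g) * r ∎)
        line : ḡ * v₀ + g * bar v₀ ≡ κ
        line = *-cancelˡ (ḡ * v₀ + g * bar v₀) κ two≢0 (begin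
          two * (ḡ * v₀ + g * bar v₀)
            ≡⟨ solve 5 (λ t ḡ g v v̄ → t :* (ḡ :* v :+ g :* v̄) := t :* ḡ :* v :+ t :* g :* v̄)
                       refl two ḡ g v₀ (bar v₀) ⟩
          two * ḡ * v₀ + two * g * bar v₀
            ≡⟨ cong₂ _+_ 2ḡ*v₀≡κ 2g*v̄₀≡κ ⟩
          κ + κ
            ≡⟨ solve 1 (λ κ → κ :+ κ := :two :* κ) refl κ ⟩
          two * κ ∎)

      OnCentered⇒≡v₀ : κ * κ ≡ two * two * (g * ḡ) * r → ∀ {v} → OnCentered v → v ≡ v₀
      OnCentered⇒≡v₀ κ²≡4gḡr {v} (on-circle , on-line) = *-cancelˡ v v₀ 2ḡ≢0 (begin
        two * ḡ * v    ≡⟨ x∙y⁻¹≈ε⇒x≈y _ _ (x*x≡0⇒x≡0 [2ḡv-κ]²≡0) ⟩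
        κ              ≡⟨ 2ḡ*v₀≡κ ⟨
        two * ḡ * v₀   ∎)
        where
        [2ḡv-κ]²≡0 : (two * ḡ * v - κ) * (two * ḡ * v - κ) ≡ 0#
        [2ḡv-κ]²≡0 = begin
          (two * ḡ * v - κ) * (two * ḡ * v - κ)
            ≡⟨ cong (λ κ′ → (two * ḡ * v - κ′) * (two * ḡ * v - κ′)) (sym on-line) ⟩
          (two * ḡ * v - (ḡ * v + g * bar v)) * (two * ḡ * v - (ḡ * v + g * bar v))
            ≡⟨ solve 4 (λ ḡ g v v̄ → let l = ḡ :* v :+ g :* v̄ in
                          (:two :* ḡ :* v :- l) :* (:two :* ḡ :* v :- l) := l :* l :- :two :* :two :* (g :* ḡ) :* (v :* v̄))
                       refl ḡ g v (bar v) ⟩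
          (ḡ * v + g * bar v) * (ḡ * v + g * bar v) - two * two * (g * ḡ) * (v * bar v)
            ≡⟨ cong₂ (λ κ′ r′ → κ′ * κ′ - two * two * (g * ḡ) * r′) on-line on-circle ⟩
          κ * κ - two * two * (g * ḡ) * r
            ≡⟨ x≈y⇒x∙y⁻¹≈ε κ²≡4gḡr ⟩
          0# ∎

      ⇒unique : κ * κ ≡ two * two * (g * ḡ) * r → UniqueIntersection (B¹ c r) (B² g k)
      ⇒unique κ²≡4gḡr = just (c + v₀) , proj₁ on-both , proj₂ on-both , unique
        where
        on-both : B¹ c r (just (c + v₀)) × B² g k (just (c + v₀))
        on-both = uncentered v₀ (v₀-OnCentered κ²≡4gḡr)
        unique : ∀ y → B¹ c r y → B² g k y → y ≡ just (c + v₀)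
        unique (just z) on-circle on-line = cong just (begin
          z             ≡⟨ solve 2 (λ z c → z := c :+ (z :- c)) refl z c ⟩
          c + (z - c)   ≡⟨ cong (c +_) (OnCentered⇒≡v₀ κ²≡4gḡr (centered z on-circle on-line)) ⟩
          c + v₀        ∎)

      unique⇔ : UniqueIntersection (B¹ c r) (B² g k) ⇔ (κ * κ ≡ two * two * (g * ḡ) * r)
      unique⇔ = mk⇔ unique⇒ ⇒unique

    B¹-B²-unique⇔ : ∀ {c r g k} → g ≢ 0# → InGFq k →
      UniqueIntersection (B¹ c r) (B² g k) ⇔ (offset c g k * offset c g k ≡ two * two * (g * bar g) * r)
    B¹-B²-unique⇔ g≢0 k-real = CircleLine.unique⇔ g≢0 k-real

    B¹-tangent⇔unique : ∀ {c r} {D : Circle} → r ≢ 0# → Tangent (B¹ c r) D ⇔ UniqueIntersection (B¹ c r) D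
    B¹-tangent⇔unique {c} {r} {D} r≢0 = mk⇔ proj₂ (λ unique → distinct unique , unique)
      where
      -- As r ≢ 0#, the antipode c + c - z of the common point z is another point of B¹ c r.
      distinct : UniqueIntersection (B¹ c r) D → ¬ (∀ x → B¹ c r x ⇔ D x)
      distinct (just z , on-circle , _ , unique) B¹≐D = r≢0 (begin
        r                              ≡⟨ on-circle ⟨
        (z - c) * (bar z - bar c)      ≡⟨ cong (_* (bar z - bar c)) z-c≡0 ⟩
        0# * (bar z - bar c)           ≡⟨ zeroˡ _ ⟩
        0#                             ∎)
        where
        z′ : Carrier
        z′ = c + c - z
        on-circle′ : B¹ c r (just z′)
        on-circle′ = begin
          (c + c - z - c) * (bar (c + c - z) - bar c)
            ≡⟨ cong (λ w → (c + c - z - c) * (w - bar c)) (trans (bar-- (c + c) z) (cong (_- bar z) (bar-+ c c))) ⟩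
          (c + c - z - c) * (bar c + bar c - bar z - bar c)
            ≡⟨ solve 4 (λ c z c̄ z̄ → (c :+ c :- z :- c) :* (c̄ :+ c̄ :- z̄ :- c̄)
                                      := (z :- c) :* (z̄ :- c̄)) refl c z (bar c) (bar z) ⟩
          (z - c) * (bar z - bar c)
            ≡⟨ on-circle ⟩
          r ∎
        z′≡z : z′ ≡ z
        z′≡z = just-injective (unique (just z′) on-circle′ (Equivalence.to (B¹≐D (just z′)) on-circle′))
        z-c≡0 : z - c ≡ 0#
        z-c≡0 = x*y≡0⇒y≡0 two≢0 (begin
          two * (z - c)     ≡⟨ solve 2 (λ z c → :two :* (z :- c) := z :- (c :+ c :- z)) refl z c ⟩
          z - z′            ≡⟨ cong (λ w → z - w) z′≡z ⟩
          z - z             ≡⟨ -‿inverseʳ z ⟩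
          0#                ∎)

    unique-intersection-resp : ∀ {C D E : Circle} → (∀ x → C x → (D x ⇔ E x)) →
                               UniqueIntersection C D ⇔ UniqueIntersection C E
    unique-intersection-resp {C} D⇔E = mk⇔ (transport D⇔E) (transport (λ x Cx → ⇔-sym (D⇔E x Cx)))
      where
      transport : ∀ {D E : Circle} → (∀ x → C x → (D x ⇔ E x)) → UniqueIntersection C D → UniqueIntersection C E
      transport D⇔E (x , Cx , Dx , unique) =
        x , Cx , Equivalence.to (D⇔E x Cx) Dx , λ y Cy Ey → unique y Cy (Equivalence.from (D⇔E y Cy) Ey)

    radical-constant : Carrier → Carrier → Carrier → Carrier → Carrier
    radical-constant a r₁ b r₂ = r₁ - a * bar a + b * bar b - r₂

    radical-axis : ∀ {a r₁ b r₂} x → B¹ a r₁ x → (B¹ b r₂ x ⇔ B² (b - a) (radical-constant a r₁ b r₂) x)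
    radical-axis {a} {r₁} {b} {r₂} (just z) on-circle = x+y≡s⇒[x≡t⇔y≡s-t] (begin
      (z - b) * (bar z - bar b) + (bar (b - a) * z + (b - a) * bar z)
        ≡⟨ cong (λ w → (z - b) * (bar z - bar b) + (w * z + (b - a) * bar z)) (bar-- b a) ⟩
      (z - b) * (bar z - bar b) + ((bar b - bar a) * z + (b - a) * bar z)
        ≡⟨ solve 6 (λ z z̄ a ā b b̄ → (z :- b) :* (z̄ :- b̄) :+ ((b̄ :- ā) :* z :+ (b :- a) :* z̄)
                                    := (z :- a) :* (z̄ :- ā) :- a :* ā :+ b :* b̄) refl z (bar z) a (bar a) b (bar b) ⟩
      (z - a) * (bar z - bar a) - a * bar a + b * bar b
        ≡⟨ cong (λ w → w - a * bar a + b * bar b) on-circle ⟩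
      r₁ - a * bar a + b * bar b ∎)

    B¹-B¹-tangent⇔ : ∀ {a r₁ b r₂} → r₁ ≢ 0# → b ≢ a → InGFq r₁ → InGFq r₂ →
      let κ = offset a (b - a) (radical-constant a r₁ b r₂) in
      Tangent (B¹ a r₁) (B¹ b r₂) ⇔ (κ * κ ≡ two * two * ((b - a) * bar (b - a)) * r₁)
    B¹-B¹-tangent⇔ {a} {r₁} {b} {r₂} r₁≢0 b≢a r₁-real r₂-real =
      ⇔-trans (B¹-tangent⇔unique r₁≢0)
        (⇔-trans (unique-intersection-resp radical-axis) (B¹-B²-unique⇔ b-a≢0 k-real))
      where
      b-a≢0 : b - a ≢ 0#
      b-a≢0 b-a≡0 = b≢a (x∙y⁻¹≈ε⇒x≈y b a b-a≡0)
      k-real : InGFq (radical-constant a r₁ b r₂)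
      k-real = begin
        bar (r₁ - a * bar a + b * bar b - r₂)
          ≡⟨ bar-- _ r₂ ⟩
        bar (r₁ - a * bar a + b * bar b) - bar r₂
          ≡⟨ cong (_- bar r₂) (bar-+ _ (b * bar b)) ⟩
        bar (r₁ - a * bar a) + bar (b * bar b) - bar r₂
          ≡⟨ cong (λ w → w + bar (b * bar b) - bar r₂) (bar-- r₁ (a * bar a)) ⟩
        bar r₁ - bar (a * bar a) + bar (b * bar b) - bar r₂
          ≡⟨ cong₂ (λ s t → s - bar (a * bar a) + bar (b * bar b) - t) r₁-real r₂-real ⟩
        r₁ - bar (a * bar a) + bar (b * bar b) - r₂
          ≡⟨ cong₂ (λ s t → r₁ - s + t - r₂) (bar-norm a) (bar-norm b) ⟩
        r₁ - a * bar a + b * bar b - r₂ ∎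

    module AxisCircles {γ a r₁ b r₂ : Carrier} (γ²≢γ̄² : γ * γ ≢ bar γ * bar γ) (r₁≢0 : r₁ ≢ 0#)
      (a-tangent : Tangent (B¹ a r₁) (B² γ 0#)) (b-tangent : Tangent (B¹ b r₂) (B² γ 0#))
      (a-real : a ≡ bar a) (b-imaginary : b ≡ - bar b) where

      σ δ M : Carrier
      σ = γ + bar γ
      δ = γ - bar γ
      M = two * two * (γ * bar γ)

      γ≢0 : γ ≢ 0#
      γ≢0 γ≡0 = γ²≢γ̄² (begin
        γ * γ              ≡⟨ cong (λ w → w * w) γ≡0 ⟩
        0# * 0#            ≡⟨ cong (λ w → w * w) bar-0 ⟨
        bar 0# * bar 0#    ≡⟨ cong (λ w → bar w * bar w) γ≡0 ⟨
        bar γ * bar γ      ∎)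

      σ≢0 : σ ≢ 0#
      σ≢0 σ≡0 = γ²≢γ̄² (x∙y⁻¹≈ε⇒x≈y _ _ (begin
        γ * γ - bar γ * bar γ   ≡⟨ solve 2 (λ g ḡ → g :* g :- ḡ :* ḡ := (g :+ ḡ) :* (g :- ḡ)) refl γ (bar γ) ⟩
        σ * δ                   ≡⟨ cong (_* δ) σ≡0 ⟩
        0# * δ                  ≡⟨ zeroˡ δ ⟩
        0#                      ∎))

      M≢0 : M ≢ 0#
      M≢0 = *-≢0 (*-≢0 two≢0 two≢0) (*-≢0 γ≢0 (bar-≢0 γ≢0))

      ā≡a : bar a ≡ a
      ā≡a = sym a-real

      b̄≡-b : bar b ≡ - b
      b̄≡-b = trans (cong bar b-imaginary) (trans (bar-neg (bar b)) (cong -_ (bar-bar b)))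

      M*r≡offset² : ∀ {c r} → Tangent (B¹ c r) (B² γ 0#) → M * r ≡ offset c γ 0# * offset c γ 0#
      M*r≡offset² tangent = sym (Equivalence.to (B¹-B²-unique⇔ γ≢0 bar-0) (proj₂ tangent))

      M*r₁≡[σa]² : M * r₁ ≡ σ * a * (σ * a)
      M*r₁≡[σa]² = begin
        M * r₁
          ≡⟨ M*r≡offset² a-tangent ⟩
        (0# - (bar γ * a + γ * bar a)) * (0# - (bar γ * a + γ * bar a))
          ≡⟨ cong (λ w → (0# - (bar γ * a + γ * w)) * (0# - (bar γ * a + γ * w))) ā≡a ⟩
        (0# - (bar γ * a + γ * a)) * (0# - (bar γ * a + γ * a))
          ≡⟨ solve 3 (λ g ḡ a → (:zero :- (ḡ :* a :+ g :* a)) :* (:zero :- (ḡ :* a :+ g :* a))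
                                := (g :+ ḡ) :* a :* ((g :+ ḡ) :* a)) refl γ (bar γ) a ⟩
        σ * a * (σ * a) ∎

      M*r₂≡[δb]² : M * r₂ ≡ δ * b * (δ * b)
      M*r₂≡[δb]² = begin
        M * r₂
          ≡⟨ M*r≡offset² b-tangent ⟩
        (0# - (bar γ * b + γ * bar b)) * (0# - (bar γ * b + γ * bar b))
          ≡⟨ cong (λ w → (0# - (bar γ * b + γ * w)) * (0# - (bar γ * b + γ * w))) b̄≡-b ⟩
        (0# - (bar γ * b + γ * - b)) * (0# - (bar γ * b + γ * - b))
          ≡⟨ solve 3 (λ g ḡ b → (:zero :- (ḡ :* b :+ g :* :- b)) :* (:zero :- (ḡ :* b :+ g :* :- b))
                                := (g :- ḡ) :* b :* ((g :- ḡ) :* b)) refl γ (bar γ) b ⟩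
        δ * b * (δ * b) ∎

      a≢0 : a ≢ 0#
      a≢0 a≡0 = r₁≢0 (x*y≡0⇒y≡0 M≢0 (begin
        M * r₁              ≡⟨ M*r₁≡[σa]² ⟩
        σ * a * (σ * a)     ≡⟨ cong (λ w → σ * w * (σ * w)) a≡0 ⟩
        σ * 0# * (σ * 0#)   ≡⟨ solve 1 (λ σ → σ :* :zero :* (σ :* :zero) := :zero) refl σ ⟩
        0#                  ∎))

      b≢a : b ≢ a
      b≢a b≡a = a≢0 (x*y≡0⇒y≡0 two≢0 (begin
        two * a             ≡⟨ solve 1 (λ a → :two :* a := a :+ a) refl a ⟩
        a + a               ≡⟨ cong (a +_) a≡-a ⟩
        a - a               ≡⟨ -‿inverseʳ a ⟩
        0#                  ∎))
        where
        a≡-a : a ≡ - a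
        a≡-a = trans (sym b≡a) (trans b-imaginary (trans (cong (λ w → - bar w) b≡a) (cong (λ w → - w) ā≡a)))

      κ : Carrier
      κ = offset a (b - a) (radical-constant a r₁ b r₂)

      a²-b² : Carrier
      a²-b² = a * a - b * b

      κ≡ : κ ≡ r₁ - r₂ + a²-b²
      κ≡ = begin
        r₁ - a * bar a + b * bar b - r₂ - (bar (b - a) * a + (b - a) * bar a)
          ≡⟨ cong (λ w → r₁ - a * bar a + b * bar b - r₂ - (w * a + (b - a) * bar a)) (bar-- b a) ⟩
        r₁ - a * bar a + b * bar b - r₂ - ((bar b - bar a) * a + (b - a) * bar a)
          ≡⟨ cong₂ (λ s t → r₁ - a * t + b * s - r₂ - ((s - t) * a + (b - a) * t)) b̄≡-b ā≡a ⟩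
        r₁ - a * a + b * - b - r₂ - ((- b - a) * a + (b - a) * a)
          ≡⟨ solve 4 (λ r₁ r₂ a b → r₁ :- a :* a :+ b :* :- b :- r₂ :- ((:- b :- a) :* a :+ (b :- a) :* a)
                                 := r₁ :- r₂ :+ (a :* a :- b :* b)) refl r₁ r₂ a b ⟩
        r₁ - r₂ + a²-b²
          ∎

      d*d̄≡ : (b - a) * bar (b - a) ≡ a²-b²
      d*d̄≡ = begin
        (b - a) * bar (b - a)   ≡⟨ cong ((b - a) *_) (trans (bar-- b a) (cong₂ _-_ b̄≡-b ā≡a)) ⟩
        (b - a) * (- b - a)     ≡⟨ solve 2 (λ a b → (b :- a) :* (:- b :- a) := a :* a :- b :* b) refl a b ⟩
        a²-b²                   ∎

      t : Carrier
      t = a * (δ / σ)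

      D : Carrier
      D = b * σ * (b * σ) - a * δ * (a * δ)

      M²[κ²-4dd̄r₁]≡D² : M * M * (κ * κ - two * two * ((b - a) * bar (b - a)) * r₁) ≡ D * D
      M²[κ²-4dd̄r₁]≡D² = begin
        M * M * (κ * κ - two * two * ((b - a) * bar (b - a)) * r₁)
          ≡⟨ cong₂ (λ k e → M * M * (k * k - two * two * e * r₁)) κ≡ d*d̄≡ ⟩
        M * M * ((r₁ - r₂ + a²-b²) * (r₁ - r₂ + a²-b²) - two * two * a²-b² * r₁)
          ≡⟨ solve 4 (λ M r₁ r₂ e → M :* M :* ((r₁ :- r₂ :+ e) :* (r₁ :- r₂ :+ e) :- :two :* :two :* e :* r₁)
                                 := (M :* r₁ :- M :* r₂ :+ M :* e) :* (M :* r₁ :- M :* r₂ :+ M :* e)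
                                      :- :two :* :two :* e :* M :* (M :* r₁)) refl M r₁ r₂ a²-b² ⟩
        (M * r₁ - M * r₂ + M * a²-b²) * (M * r₁ - M * r₂ + M * a²-b²) - two * two * a²-b² * M * (M * r₁)
          ≡⟨ cong₂ (λ x y → (x - y + M * a²-b²) * (x - y + M * a²-b²) - two * two * a²-b² * M * x)
                   M*r₁≡[σa]² M*r₂≡[δb]² ⟩
        (A - B + M * a²-b²) * (A - B + M * a²-b²) - two * two * a²-b² * M * A
          ≡⟨ solve 4 (λ g ḡ a b →
                let σ = g :+ ḡ ; δ = g :- ḡ ; M = :two :* :two :* (g :* ḡ) ; e = a :* a :- b :* b
                    A = σ :* a :* (σ :* a) ; B = δ :* b :* (δ :* b) in
                (A :- B :+ M :* e) :* (A :- B :+ M :* e) :- :two :* :two :* e :* M :* A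
                := (b :* σ :* (b :* σ) :- a :* δ :* (a :* δ)) :* (b :* σ :* (b :* σ) :- a :* δ :* (a :* δ)))
               refl γ (bar γ) a b ⟩
        D * D
          ∎
        where
        A B : Carrier
        A = σ * a * (σ * a)
        B = δ * b * (δ * b)

      D≡[b²-t²]σ² : D ≡ (b * b - t * t) * (σ * σ)
      D≡[b²-t²]σ² = begin
        b * σ * (b * σ) - a * δ * (a * δ)
          ≡⟨ cong (λ w → b * σ * (b * σ) - w * w) (sym (x*[y/x]≡y (a * δ) σ≢0)) ⟩
        b * σ * (b * σ) - σ * (a * δ / σ) * (σ * (a * δ / σ))
          ≡⟨ solve 5 (λ a b δ σ σ⁻¹ → b :* σ :* (b :* σ) :- σ :* (a :* δ :* σ⁻¹) :* (σ :* (a :* δ :* σ⁻¹))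
                                    := (b :* b :- a :* (δ :* σ⁻¹) :* (a :* (δ :* σ⁻¹))) :* (σ :* σ)) refl a b δ σ (σ ⁻¹) ⟩
        (b * b - t * t) * (σ * σ) ∎

      D≡0⇔b²≡t² : D ≡ 0# ⇔ b * b ≡ t * t
      D≡0⇔b²≡t² = mk⇔
        (λ D≡0 → x∙y⁻¹≈ε⇒x≈y _ _ (x*y≡0⇒y≡0 (*-≢0 σ≢0 σ≢0)
                   (trans (*-comm _ _) (trans (sym D≡[b²-t²]σ²) D≡0))))
        (λ b²≡t² → trans D≡[b²-t²]σ² (trans (cong (_* (σ * σ)) (x≈y⇒x∙y⁻¹≈ε b²≡t²)) (zeroˡ _)))

      tangency-condition⇔ : (κ * κ ≡ two * two * ((b - a) * bar (b - a)) * r₁) ⇔ (b * b ≡ t * t)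
      tangency-condition⇔ = ⇔-trans (mk⇔ D≡0 κ²≡) D≡0⇔b²≡t²
        where
        M²≢0 : M * M ≢ 0#
        M²≢0 = *-≢0 M≢0 M≢0
        D≡0 : κ * κ ≡ two * two * ((b - a) * bar (b - a)) * r₁ → D ≡ 0#
        D≡0 κ²≡ = x*x≡0⇒x≡0 (begin
          D * D                 ≡⟨ M²[κ²-4dd̄r₁]≡D² ⟨
          M * M * (κ * κ - _)   ≡⟨ cong (M * M *_) (x≈y⇒x∙y⁻¹≈ε κ²≡) ⟩
          M * M * 0#            ≡⟨ zeroʳ _ ⟩
          0#                    ∎)
        κ²≡ : D ≡ 0# → κ * κ ≡ two * two * ((b - a) * bar (b - a)) * r₁
        κ²≡ D≡0 = x∙y⁻¹≈ε⇒x≈y _ _ (x*y≡0⇒y≡0 M²≢0 (begin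
          M * M * (κ * κ - _)   ≡⟨ M²[κ²-4dd̄r₁]≡D² ⟩
          D * D                 ≡⟨ cong (λ w → w * w) D≡0 ⟩
          0# * 0#               ≡⟨ zeroˡ 0# ⟩
          0#                    ∎))

module QuadraticExtension {p m : ℕ} (p-prime : Prime p) (p≢2 : p ≢ 2)
  (F : Field) (card : HasCard F ((p ^ m) ^ 2)) where

  open Field F
  open FieldProperties F
  open Finite card public using (_≟_)
  open Finite card using (n·x≡0; fermat)
  open WithDecidableEquality _≟_
  open Plane F (p ^ m) using (bar)
  open import Relation.Binary.PropositionalEquality using (trans; cong; module ≡-Reasoning)
  import Data.Nat as ℕ
  import Data.Nat.Properties as ℕ
  open ≡-Reasoning

  p·1≡0 : p · 1# ≡ 0#
  p·1≡0 = pow≡0⇒≡0 m (pow≡0⇒≡0 2 (begin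
    pow (pow (p · 1#) m) 2        ≡⟨ cong (λ x → pow x 2) (^·1≡pow p m) ⟨
    pow ((p ^ m) · 1#) 2          ≡⟨ ^·1≡pow (p ^ m) 2 ⟨
    ((p ^ m) ^ 2) · 1#            ≡⟨ n·x≡0 1# ⟩
    0#                            ∎))

  open Characteristic p-prime p·1≡0 using (frobenius-^; odd⇒two≢0)

  two≢0 : two ≢ 0#
  two≢0 = odd⇒two≢0 p≢2

  bar-+ : ∀ x y → bar (x + y) ≡ bar x + bar y
  bar-+ = frobenius-^ m

  bar-* : ∀ x y → bar (x * y) ≡ bar x * bar y
  bar-* x y = pow-distrib-* x y (p ^ m)

  bar-bar : ∀ x → bar (bar x) ≡ x
  bar-bar x = begin
    pow (pow x (p ^ m)) (p ^ m)       ≡⟨ pow-pow x (p ^ m) (p ^ m) ⟩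
    pow x ((p ^ m) ℕ.* (p ^ m))       ≡⟨ cong (λ k → pow x ((p ^ m) ℕ.* k)) (ℕ.*-identityʳ (p ^ m)) ⟨
    pow x ((p ^ m) ^ 2)               ≡⟨ fermat x ⟩
    x                                 ∎

lemma4p5 : (p m : ℕ) → Prime p → ¬ (p ≡ 2) → 1 ≤ m →
  (F : Field) → HasCard F ((p ^ m) ^ 2) →
  let open Field F
      open Plane F (p ^ m)
  in (γ : Carrier) → ¬ (γ * γ ≡ bar γ * bar γ) →
     (c₁ r₁ c₂ r₂ : Carrier) →
     InGFq r₁ → ¬ (r₁ ≡ 0#) → InGFq r₂ → ¬ (r₂ ≡ 0#) →
     Tangent (B¹ c₁ r₁) (B² γ 0#) → Tangent (B¹ c₁ r₁) (B² (bar γ) 0#) →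
     Tangent (B¹ c₂ r₂) (B² γ 0#) → Tangent (B¹ c₂ r₂) (B² (bar γ) 0#) →
     c₁ ≡ bar c₁ → c₂ ≡ - bar c₂ →
     (Tangent (B¹ c₁ r₁) (B¹ c₂ r₂) ⇔
      (c₂ ≡ c₁ * ((γ - bar γ) * (γ + bar γ) ⁻¹)
       ⊎ c₂ ≡ - (c₁ * ((γ - bar γ) * (γ + bar γ) ⁻¹))))
lemma4p5 p m p-prime p≢2 _ F card γ γ²≢γ̄² c₁ r₁ c₂ r₂ r₁-real r₁≢0 r₂-real _
         c₁-tangent _ c₂-tangent _ c₁-real c₂-imaginary = begin
  Tangent (B¹ c₁ r₁) (B¹ c₂ r₂)                             ∼⟨ B¹-B¹-tangent⇔ r₁≢0 b≢a r₁-real r₂-real ⟩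
  κ * κ ≡ two * two * ((c₂ - c₁) * bar (c₂ - c₁)) * r₁      ∼⟨ tangency-condition⇔ ⟩
  c₂ * c₂ ≡ t * t                                           ∼⟨ x*x≡y*y⇔x≡y⊎x≡-y ⟩
  (c₂ ≡ t ⊎ c₂ ≡ - t)                                       ∎
  where
  open Field F
  open FieldProperties F
  open Plane F (p ^ m)
  open QuadraticExtension {m = m} p-prime p≢2 F card
  open WithDecidableEquality _≟_
  open PlaneGeometry F (p ^ m)
  open WithConjugation _≟_ two≢0 bar-+ bar-* bar-bar
  open AxisCircles γ²≢γ̄² r₁≢0 c₁-tangent c₂-tangent c₁-real c₂-imaginary
  open Related.EquationalReasoning {k = Related.equivalence}
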